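{- Let $L\in\mathrm{Mat}_N(\mathbb{Z})$ be the Gram matrix of an even positive definite lattice, and let $\mathcal{R}$ be a set of representatives of $(\mathbb{Z}^N/L\mathbb{Z}^N)/\{\pm1\}$ such that each $r\in\mathcal{R}$ has minimal value $L[r]$ in $r+L\mathbb{Z}^N$. Let $r\in\mathcal{R}\cup-\mathcal{R}$. Then there is a finite set $\mathcal{S}^{\mathrm{str}}(r)\subset\mathbb{Z}^N$ that spans $\mathbb{Z}^N$ and has the following property: whenever $s^{\mathrm{tr}}r=s^{\mathrm{tr}}r'$ for some $s\in\mathcal{S}^{\mathrm{str}}(r)$ and some $r'\in\bigcup_{r''\in\mathcal{R}}\big(\mathrm{neigh}(r'')\cup\mathrm{neigh}(-r'')\big)$, then $r=r'$.
   Context: $L[x]=x^{\mathrm{tr}}Lx$. For $r\in\mathbb{Z}^N$, $\mathrm{neigh}(r)=\{r'\in r+L\mathbb{Z}^N: L[r']=L[r]\}$. -}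

module Defs where

open import Data.Nat using (ℕ; zero; suc)
open import Data.Integer using (ℤ; 0ℤ; _+_; _*_; -_; _-_; _≤_; _<_)
open import Data.Fin using (Fin)
open import Data.Vec using (Vec; []; _∷_; map; zipWith; replicate; lookup)
open import Data.List using (List; length)
import Data.List as List
open import Data.Product using (Σ; ∃; _×_)
open import Data.Sum using (_⊎_)
open import Relation.Binary.PropositionalEquality using (_≡_; _≢_)

Vecℤ : ℕ → Set
Vecℤ N = Vec ℤ N

Mat : ℕ → Set
Mat N = Vec (Vec ℤ N) N

dot : ∀ {n} → Vec ℤ n → Vec ℤ n → ℤ
dot []       []       = 0ℤ
dot (x ∷ xs) (y ∷ ys) = x * y + dot xs ys

mulV : ∀ {N} → Mat N → Vecℤ N → Vecℤ N
mulV L x = map (λ row → dot row x) L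

qf : ∀ {N} → Mat N → Vecℤ N → ℤ
qf L x = dot x (mulV L x)

neg : ∀ {N} → Vecℤ N → Vecℤ N
neg = map (λ a → - a)

sub : ∀ {N} → Vecℤ N → Vecℤ N → Vecℤ N
sub = zipWith _-_

entry : ∀ {N} → Mat N → Fin N → Fin N → ℤ
entry L i j = lookup (lookup L i) j

IsEvenPosDefGram : ∀ {N} → Mat N → Set
IsEvenPosDefGram {N} L =
  (∀ i j → entry L i j ≡ entry L j i)
  × (∀ i → ∃ λ k → entry L i i ≡ (Data.Integer.+ 2) * k)
  × (∀ (x : Vecℤ N) → (∃ λ i → lookup x i ≢ 0ℤ) → 0ℤ < qf L x)

CongMod : ∀ {N} → Mat N → Vecℤ N → Vecℤ N → Set
CongMod {N} L x y = ∃ λ (v : Vecℤ N) → sub x y ≡ mulV L v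

Neigh : ∀ {N} → Mat N → Vecℤ N → Vecℤ N → Set
Neigh L r r' = CongMod L r' r × qf L r' ≡ qf L r

IsMinimalReps : ∀ {N} → Mat N → (Vecℤ N → Set) → Set
IsMinimalReps {N} L R =
  (∀ (x : Vecℤ N) → ∃ λ r → R r × (CongMod L x r ⊎ CongMod L x (neg r)))
  × (∀ r r' → R r → R r' → (CongMod L r r' ⊎ CongMod L r (neg r')) → r ≡ r')
  × (∀ r → R r → ∀ y → CongMod L y r → qf L r ≤ qf L y)

comb : ∀ {N} → (S : List (Vecℤ N)) → Vec ℤ (length S) → Vecℤ N
comb {N} List.[]      []       = replicate N 0ℤ
comb {N} (s List.∷ S) (c ∷ cs) = zipWith _+_ (map (c *_) s) (comb S cs)

Spans : ∀ {N} → List (Vecℤ N) → Set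
Spans {N} S = ∀ (x : Vecℤ N) → ∃ λ (cs : Vec ℤ (length S)) → comb S cs ≡ x

{-# OPTIONS --safe #-}

-- If x has minimal L[x] in x + Lℤᴺ, comparing it with x ± L eᵢ gives
-- 2∣(L² x)ᵢ∣ ≤ L[L eᵢ]; since a positive definite L maps only bounded vectors to
-- bounded ones (fraction-free Gaussian elimination), all such x lie in one box
-- [−C, C]ᴺ. Both r and every neighbour r′ are of this kind. A super-increasing
-- t, each entry exceeding 2C times the ℓ¹-norm of the later ones, makes
-- x ↦ tᵗʳ x injective on the box, and so does every t + eᵢ; these span ℤᴺ as
-- eᵢ = (t + eᵢ) − t.

module Submission where

open import Defs
open import Data.Nat as ℕ using (ℕ; zero; suc)
import Data.Nat.Properties as ℕP
open import Data.Integer using (ℤ; +_; 0ℤ; 1ℤ; ∣_∣; _+_; _*_; -_; _-_; _≤_; _<_)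
import Data.Integer as ℤ
import Data.Integer.Properties as ℤP
open import Data.Integer.Tactic.RingSolver using (solve-∀)
open import Data.Fin using (Fin; zero; suc)
open import Data.Vec using (Vec; []; _∷_; map; zipWith; replicate; lookup; head; tabulate)
import Data.Vec.Properties as VecP
open import Data.Vec.Relation.Unary.All as All using (All; []; _∷_)
open import Data.Vec.Relation.Unary.All.Properties using (lookup⁺; lookup⁻)
open import Data.List using (List; length)
import Data.List as List
open import Data.List.Membership.Propositional using (_∈_)
open import Data.List.Membership.Propositional.Properties using (∈-map⁺; ∈-map⁻; ∈-allFin)
open import Data.List.Relation.Unary.Any using (here; there)
open import Data.Product using (Σ; ∃; _×_; _,_; proj₁; proj₂)
open import Data.Sum using (_⊎_; inj₁; inj₂; [_,_]′)
open import Data.Unit using (⊤; tt)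
open import Data.Empty using (⊥-elim)
open import Relation.Nullary using (yes; no)
open import Relation.Binary.PropositionalEquality

private
  variable
    m n : ℕ

infixl 6 _+ᵥ_
infixr 7 _*ᵥ_ _*ᴹ_

0ᵥ : Vec ℤ n
0ᵥ = replicate _ 0ℤ

_+ᵥ_ : Vec ℤ n → Vec ℤ n → Vec ℤ n
_+ᵥ_ = zipWith _+_

_*ᵥ_ : ℤ → Vec ℤ n → Vec ℤ n
c *ᵥ u = map (c *_) u

e : Fin n → Vec ℤ n
e zero    = 1ℤ ∷ 0ᵥ
e (suc i) = 0ℤ ∷ e i

_*ᴹ_ : Vec (Vec ℤ n) m → Vec ℤ n → Vec ℤ m
M *ᴹ x = map (λ row → dot row x) M

vec-ext : {A : Set} {u v : Vec A n} → (∀ i → lookup u i ≡ lookup v i) → u ≡ v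
vec-ext {u = u} {v} h =
  trans (sym (VecP.tabulate∘lookup u)) (trans (VecP.tabulate-cong h) (VecP.tabulate∘lookup v))

+ᵥ-identityˡ : (u : Vec ℤ n) → 0ᵥ +ᵥ u ≡ u
+ᵥ-identityˡ = VecP.zipWith-identityˡ ℤP.+-identityˡ

+ᵥ-identityʳ : (u : Vec ℤ n) → u +ᵥ 0ᵥ ≡ u
+ᵥ-identityʳ = VecP.zipWith-identityʳ ℤP.+-identityʳ

*ᵥ-zeroʳ : ∀ c → c *ᵥ 0ᵥ ≡ 0ᵥ {n}
*ᵥ-zeroʳ {zero}  c = refl
*ᵥ-zeroʳ {suc n} c = cong₂ _∷_ (ℤP.*-zeroʳ c) (*ᵥ-zeroʳ c)

*ᵥ-identityˡ : (u : Vec ℤ n) → 1ℤ *ᵥ u ≡ u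
*ᵥ-identityˡ []      = refl
*ᵥ-identityˡ (a ∷ u) = cong₂ _∷_ (ℤP.*-identityˡ a) (*ᵥ-identityˡ u)

neg-involutive : (u : Vec ℤ n) → neg (neg u) ≡ u
neg-involutive []      = refl
neg-involutive (a ∷ u) = cong₂ _∷_ (ℤP.neg-involutive a) (neg-involutive u)

sub-+ᵥ : (x u : Vec ℤ n) → sub (x +ᵥ u) x ≡ u
sub-+ᵥ []      []      = refl
sub-+ᵥ (a ∷ x) (b ∷ u) = cong₂ _∷_ (lemma a b) (sub-+ᵥ x u)
  where lemma : ∀ a b → (a + b) - a ≡ b
        lemma = solve-∀

sub-trans : (x y z : Vec ℤ n) → sub x z ≡ sub x y +ᵥ sub y z
sub-trans []      []      []      = refl
sub-trans (a ∷ x) (b ∷ y) (c ∷ z) = cong₂ _∷_ (lemma a b c) (sub-trans x y z)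
  where lemma : ∀ a b c → a - c ≡ (a - b) + (b - c)
        lemma = solve-∀

sub-neg : (x y : Vec ℤ n) → sub (neg x) y ≡ neg (sub x (neg y))
sub-neg []      []      = refl
sub-neg (a ∷ x) (b ∷ y) = cong₂ _∷_ (lemma a b) (sub-neg x y)
  where lemma : ∀ a b → - a - b ≡ - (a - - b)
        lemma = solve-∀

dot-comm : (u v : Vec ℤ n) → dot u v ≡ dot v u
dot-comm []      []      = refl
dot-comm (a ∷ u) (b ∷ v) = cong₂ _+_ (ℤP.*-comm a b) (dot-comm u v)

dot-zeroʳ : (u : Vec ℤ n) → dot u 0ᵥ ≡ 0ℤ
dot-zeroʳ []      = refl
dot-zeroʳ (a ∷ u) rewrite dot-zeroʳ u | ℤP.*-zeroʳ a = refl

dot-+ᵥʳ : (u v w : Vec ℤ n) → dot u (v +ᵥ w) ≡ dot u v + dot u w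
dot-+ᵥʳ []      []      []      = refl
dot-+ᵥʳ (a ∷ u) (b ∷ v) (c ∷ w) rewrite dot-+ᵥʳ u v w = lemma a b c (dot u v) (dot u w)
  where lemma : ∀ a b c x y → a * (b + c) + (x + y) ≡ (a * b + x) + (a * c + y)
        lemma = solve-∀

dot-+ᵥˡ : (u v w : Vec ℤ n) → dot (u +ᵥ v) w ≡ dot u w + dot v w
dot-+ᵥˡ u v w = begin
  dot (u +ᵥ v) w        ≡⟨ dot-comm (u +ᵥ v) w ⟩
  dot w (u +ᵥ v)        ≡⟨ dot-+ᵥʳ w u v ⟩
  dot w u + dot w v     ≡⟨ cong₂ _+_ (dot-comm w u) (dot-comm w v) ⟩
  dot u w + dot v w     ∎
  where open ≡-Reasoning

dot-*ᵥʳ : ∀ c (u v : Vec ℤ n) → dot u (c *ᵥ v) ≡ c * dot u v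
dot-*ᵥʳ c []      []      = sym (ℤP.*-zeroʳ c)
dot-*ᵥʳ c (a ∷ u) (b ∷ v) rewrite dot-*ᵥʳ c u v = lemma c a b (dot u v)
  where lemma : ∀ c a b x → a * (c * b) + c * x ≡ c * (a * b + x)
        lemma = solve-∀

dot-*ᵥˡ : ∀ c (u v : Vec ℤ n) → dot (c *ᵥ u) v ≡ c * dot u v
dot-*ᵥˡ c u v = trans (dot-comm (c *ᵥ u) v) (trans (dot-*ᵥʳ c v u) (cong (c *_) (dot-comm v u)))

dot-negʳ : (u v : Vec ℤ n) → dot u (neg v) ≡ - dot u v
dot-negʳ []      []      = refl
dot-negʳ (a ∷ u) (b ∷ v) rewrite dot-negʳ u v = lemma a b (dot u v)
  where lemma : ∀ a b x → a * - b + - x ≡ - (a * b + x)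
        lemma = solve-∀

dot-negˡ : (u v : Vec ℤ n) → dot (neg u) v ≡ - dot u v
dot-negˡ u v = trans (dot-comm (neg u) v) (trans (dot-negʳ v u) (cong -_ (dot-comm v u)))

dot-neg-neg : (u v : Vec ℤ n) → dot (neg u) (neg v) ≡ dot u v
dot-neg-neg u v = begin
  dot (neg u) (neg v)   ≡⟨ dot-negˡ u (neg v) ⟩
  - dot u (neg v)       ≡⟨ cong -_ (dot-negʳ u v) ⟩
  - - dot u v           ≡⟨ ℤP.neg-involutive (dot u v) ⟩
  dot u v               ∎
  where open ≡-Reasoning

dot-e : (i : Fin n) (y : Vec ℤ n) → dot (e i) y ≡ lookup y i
dot-e zero    (a ∷ y) = begin
  1ℤ * a + dot 0ᵥ y  ≡⟨ cong (_+_ (1ℤ * a)) (trans (dot-comm 0ᵥ y) (dot-zeroʳ y)) ⟩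
  1ℤ * a + 0ℤ        ≡⟨ ℤP.+-identityʳ (1ℤ * a) ⟩
  1ℤ * a             ≡⟨ ℤP.*-identityˡ a ⟩
  a                  ∎
  where open ≡-Reasoning
dot-e (suc i) (a ∷ y) = trans (ℤP.+-identityˡ (dot (e i) y)) (dot-e i y)

*ᴹ-+ᵥ : (M : Vec (Vec ℤ n) m) (u v : Vec ℤ n) → M *ᴹ (u +ᵥ v) ≡ M *ᴹ u +ᵥ M *ᴹ v
*ᴹ-+ᵥ []        u v = refl
*ᴹ-+ᵥ (row ∷ M) u v = cong₂ _∷_ (dot-+ᵥʳ row u v) (*ᴹ-+ᵥ M u v)

*ᴹ-neg : (M : Vec (Vec ℤ n) m) (u : Vec ℤ n) → M *ᴹ neg u ≡ neg (M *ᴹ u)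
*ᴹ-neg []        u = refl
*ᴹ-neg (row ∷ M) u = cong₂ _∷_ (dot-negʳ row u) (*ᴹ-neg M u)

_ᵀ : Vec (Vec ℤ n) m → Vec (Vec ℤ m) n
[]        ᵀ = replicate _ []
(row ∷ M) ᵀ = zipWith _∷_ row (M ᵀ)

lookup-ᵀ : (M : Vec (Vec ℤ n) m) (i : Fin m) (j : Fin n) →
           lookup (lookup (M ᵀ) j) i ≡ lookup (lookup M i) j
lookup-ᵀ (row ∷ M) i j =
  trans (cong (λ col → lookup col i) (VecP.lookup-zipWith _∷_ j row (M ᵀ))) (by-row i)
  where
  by-row : ∀ i → lookup (lookup row j ∷ lookup (M ᵀ) j) i ≡ lookup (lookup (row ∷ M) i) j
  by-row zero    = refl
  by-row (suc i) = lookup-ᵀ M i j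

*ᴹ-zipWith-∷ : (col : Vec ℤ m) (T : Vec (Vec ℤ n) m) (a : ℤ) (x : Vec ℤ n) →
               zipWith _∷_ col T *ᴹ (a ∷ x) ≡ a *ᵥ col +ᵥ T *ᴹ x
*ᴹ-zipWith-∷ []        []      a x = refl
*ᴹ-zipWith-∷ (c ∷ col) (t ∷ T) a x =
  cong₂ _∷_ (cong (_+ dot t x) (ℤP.*-comm c a)) (*ᴹ-zipWith-∷ col T a x)

dot-*ᴹ-ᵀ : (M : Vec (Vec ℤ n) m) (x : Vec ℤ m) (y : Vec ℤ n) → dot x (M *ᴹ y) ≡ dot y (M ᵀ *ᴹ x)
dot-*ᴹ-ᵀ {n} [] [] y = begin
  0ℤ                            ≡⟨ sym (dot-zeroʳ y) ⟩
  dot y 0ᵥ                      ≡⟨ cong (dot y) (sym (VecP.map-replicate (λ row → dot row []) [] n)) ⟩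
  dot y (replicate n [] *ᴹ [])  ∎
  where open ≡-Reasoning
dot-*ᴹ-ᵀ (row ∷ M) (a ∷ x) y = begin
  a * dot row y + dot x (M *ᴹ y)            ≡⟨ cong₂ _+_ (cong (a *_) (dot-comm row y)) (dot-*ᴹ-ᵀ M x y) ⟩
  a * dot y row + dot y (M ᵀ *ᴹ x)          ≡⟨ cong (_+ dot y (M ᵀ *ᴹ x)) (sym (dot-*ᵥʳ a y row)) ⟩
  dot y (a *ᵥ row) + dot y (M ᵀ *ᴹ x)       ≡⟨ sym (dot-+ᵥʳ y (a *ᵥ row) (M ᵀ *ᴹ x)) ⟩
  dot y (a *ᵥ row +ᵥ M ᵀ *ᴹ x)              ≡⟨ cong (dot y) (sym (*ᴹ-zipWith-∷ row (M ᵀ) a x)) ⟩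
  dot y (zipWith _∷_ row (M ᵀ) *ᴹ (a ∷ x))  ∎
  where open ≡-Reasoning

IsSymmetric : Mat n → Set
IsSymmetric L = ∀ i j → entry L i j ≡ entry L j i

dot-*ᴹ-sym : {L : Mat n} → IsSymmetric L → (x y : Vec ℤ n) → dot x (L *ᴹ y) ≡ dot y (L *ᴹ x)
dot-*ᴹ-sym {L = L} sym-L x y = trans (dot-*ᴹ-ᵀ L x y) (cong (λ M → dot y (M *ᴹ x)) Lᵀ≡L)
  where
  Lᵀ≡L : L ᵀ ≡ L
  Lᵀ≡L = vec-ext λ j → vec-ext λ i → trans (lookup-ᵀ L i j) (sym-L i j)

qf-neg : (L : Mat n) (x : Vec ℤ n) → qf L (neg x) ≡ qf L x
qf-neg L x = trans (cong (dot (neg x)) (*ᴹ-neg L x)) (dot-neg-neg x (L *ᴹ x))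

ClassMinimal : Mat n → Vec ℤ n → Set
ClassMinimal L c = ∀ y → CongMod L y c → qf L c ≤ qf L y

classMinimal-neigh : {L : Mat n} {c r′ : Vec ℤ n} → ClassMinimal L c → Neigh L c r′ → ClassMinimal L r′
classMinimal-neigh {L = L} {c} {r′} min-c ((v₀ , r′≡c) , same-qf) y (v , y≡r′) =
  subst (_≤ qf L y) (sym same-qf) (min-c y (v +ᵥ v₀ , y≡c))
  where
  open ≡-Reasoning
  y≡c : sub y c ≡ L *ᴹ (v +ᵥ v₀)
  y≡c = begin
    sub y c               ≡⟨ sub-trans y r′ c ⟩
    sub y r′ +ᵥ sub r′ c  ≡⟨ cong₂ _+ᵥ_ y≡r′ r′≡c ⟩
    L *ᴹ v +ᵥ L *ᴹ v₀     ≡⟨ sym (*ᴹ-+ᵥ L v v₀) ⟩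
    L *ᴹ (v +ᵥ v₀)        ∎

classMinimal-neg : {L : Mat n} {c : Vec ℤ n} → ClassMinimal L c → ClassMinimal L (neg c)
classMinimal-neg {L = L} {c} min-c y (v , y≡-c) =
  subst₂ _≤_ (sym (qf-neg L c)) (qf-neg L y) (min-c (neg y) (neg v , -y≡c))
  where
  open ≡-Reasoning
  -y≡c : sub (neg y) c ≡ L *ᴹ neg v
  -y≡c = begin
    sub (neg y) c          ≡⟨ sub-neg y c ⟩
    neg (sub y (neg c))    ≡⟨ cong neg y≡-c ⟩
    neg (L *ᴹ v)           ≡⟨ sym (*ᴹ-neg L v) ⟩
    L *ᴹ neg v             ∎

qf-+ᵥ-*ᴹ : {L : Mat n} → IsSymmetric L → (x w : Vec ℤ n) →
           let D = dot w (L *ᴹ L *ᴹ x) in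
           qf L (x +ᵥ L *ᴹ w) ≡ qf L x + ((D + D) + qf L (L *ᴹ w))
qf-+ᵥ-*ᴹ {L = L} sym-L x w = begin
  qf L (x +ᵥ v)                                 ≡⟨ cong (dot (x +ᵥ v)) (*ᴹ-+ᵥ L x v) ⟩
  dot (x +ᵥ v) (Lx +ᵥ Lv)                       ≡⟨ dot-+ᵥˡ x v (Lx +ᵥ Lv) ⟩
  dot x (Lx +ᵥ Lv) + dot v (Lx +ᵥ Lv)           ≡⟨ cong₂ _+_ (dot-+ᵥʳ x Lx Lv) (dot-+ᵥʳ v Lx Lv) ⟩
  (qf L x + dot x Lv) + (dot v Lx + qf L v)     ≡⟨ cong₂ (λ p q → (qf L x + p) + (q + qf L v)) x·Lv≡D v·Lx≡D ⟩
  (qf L x + D) + (D + qf L v)                   ≡⟨ regroup (qf L x) D (qf L v) ⟩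
  qf L x + ((D + D) + qf L v)                   ∎
  where
  open ≡-Reasoning
  v = L *ᴹ w
  Lx = L *ᴹ x
  Lv = L *ᴹ v
  D = dot w (L *ᴹ Lx)
  v·Lx≡D : dot v Lx ≡ D
  v·Lx≡D = trans (dot-comm v Lx) (dot-*ᴹ-sym sym-L Lx w)
  x·Lv≡D : dot x Lv ≡ D
  x·Lv≡D = trans (dot-*ᴹ-sym sym-L x v) v·Lx≡D
  regroup : ∀ q d r → (q + d) + (d + r) ≡ q + ((d + d) + r)
  regroup = solve-∀

-- x + L w lies in the class of x, so the cross and quadratic terms of
-- qf-+ᵥ-*ᴹ are jointly nonnegative.
classMinimal-translate : {L : Mat n} {x : Vec ℤ n} → IsSymmetric L → ClassMinimal L x → ∀ w →
                         let D = dot w (L *ᴹ L *ᴹ x) in - D + - D ≤ qf L (L *ᴹ w)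
classMinimal-translate {L = L} {x} sym-L min-x w =
  ℤP.0≤i-j⇒j≤i (subst (0ℤ ≤_) (cancel (qf L x) D Q) (ℤP.i≤j⇒0≤j-i x≤translate))
  where
  D = dot w (L *ᴹ L *ᴹ x)
  Q = qf L (L *ᴹ w)
  x≤translate : qf L x ≤ qf L x + ((D + D) + Q)
  x≤translate = subst (qf L x ≤_) (qf-+ᵥ-*ᴹ sym-L x w) (min-x (x +ᵥ L *ᴹ w) (w , sub-+ᵥ x (L *ᴹ w)))
  cancel : ∀ q d Q → (q + ((d + d) + Q)) - q ≡ Q - (- d + - d)
  cancel = solve-∀

i+i≤j⇒-i+-i≤j⇒∣i∣≤∣j∣ : ∀ i j → i + i ≤ j → - i + - i ≤ j → ∣ i ∣ ℕ.≤ ∣ j ∣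
i+i≤j⇒-i+-i≤j⇒∣i∣≤∣j∣ i j i+i≤j -i+-i≤j = begin
  ∣ i ∣             ≤⟨ ℕP.m≤m+n ∣ i ∣ ∣ i ∣ ⟩
  ∣ i ∣ ℕ.+ ∣ i ∣   ≤⟨ ℤP.drop‿+≤+ (subst (+ ∣ i ∣ + + ∣ i ∣ ≤_) (sym (ℤP.0≤i⇒+∣i∣≡i 0≤j)) ∣i∣+∣i∣≤j) ⟩
  ∣ j ∣             ∎
  where
  open ℕP.≤-Reasoning
  ∣i∣+∣i∣≤j : + ∣ i ∣ + + ∣ i ∣ ≤ j
  ∣i∣+∣i∣≤j = [ (λ eq → subst (λ p → p + p ≤ j) (sym eq) i+i≤j)
              , (λ eq → subst (λ p → p + p ≤ j) (sym eq) -i+-i≤j) ]′ (ℤP.+∣i∣≡i⊎+∣i∣≡-i i)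
  0≤j : 0ℤ ≤ j
  0≤j = ℤP.≤-trans (ℤ.+≤+ ℕ.z≤n) ∣i∣+∣i∣≤j

classMinimal-coordinate : {L : Mat n} {x : Vec ℤ n} → IsSymmetric L → ClassMinimal L x →
                          ∀ i → ∣ lookup (L *ᴹ L *ᴹ x) i ∣ ℕ.≤ ∣ qf L (L *ᴹ e i) ∣
classMinimal-coordinate {L = L} {x} sym-L min-x i = i+i≤j⇒-i+-i≤j⇒∣i∣≤∣j∣ yᵢ Q yᵢ+yᵢ≤Q -yᵢ+-yᵢ≤Q
  where
  y = L *ᴹ L *ᴹ x
  yᵢ = lookup y i
  Q = qf L (L *ᴹ e i)
  -yᵢ+-yᵢ≤Q : - yᵢ + - yᵢ ≤ Q
  -yᵢ+-yᵢ≤Q = subst (λ d → - d + - d ≤ Q) (dot-e i y) (classMinimal-translate sym-L min-x (e i))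
  yᵢ+yᵢ≤Q : yᵢ + yᵢ ≤ Q
  yᵢ+yᵢ≤Q = subst₂ (λ d q → d + d ≤ q)
                   (trans (cong -_ (trans (dot-negˡ (e i) y) (cong -_ (dot-e i y)))) (ℤP.neg-involutive yᵢ))
                   (trans (cong (qf L) (*ᴹ-neg L (e i))) (qf-neg L (L *ᴹ e i)))
                   (classMinimal-translate sym-L min-x (neg (e i)))

‖_‖₁ : Vec ℤ n → ℕ
‖ [] ‖₁    = 0
‖ a ∷ v ‖₁ = ∣ a ∣ ℕ.+ ‖ v ‖₁

Bounded : ℕ → Vec ℤ n → Set
Bounded b = All (λ a → ∣ a ∣ ℕ.≤ b)

bounded-mono : {b c : ℕ} {v : Vec ℤ n} → b ℕ.≤ c → Bounded b v → Bounded c v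
bounded-mono b≤c = All.map (λ h → ℕP.≤-trans h b≤c)

bounded-‖‖₁ : (v : Vec ℤ n) → Bounded ‖ v ‖₁ v
bounded-‖‖₁ []      = []
bounded-‖‖₁ (a ∷ v) = ℕP.m≤m+n ∣ a ∣ ‖ v ‖₁ ∷ bounded-mono (ℕP.m≤n+m ‖ v ‖₁ ∣ a ∣) (bounded-‖‖₁ v)

∣dot∣≤‖‖₁* : {C : ℕ} (m z : Vec ℤ n) → Bounded C z → ∣ dot m z ∣ ℕ.≤ ‖ m ‖₁ ℕ.* C
∣dot∣≤‖‖₁* []       []       []         = ℕP.≤-refl
∣dot∣≤‖‖₁* {C = C} (a ∷ m) (x ∷ z) (∣x∣≤C ∷ z≤C) = begin
  ∣ a * x + dot m z ∣                ≤⟨ ℤP.∣i+j∣≤∣i∣+∣j∣ (a * x) (dot m z) ⟩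
  ∣ a * x ∣ ℕ.+ ∣ dot m z ∣          ≡⟨ cong (ℕ._+ ∣ dot m z ∣) (ℤP.∣i*j∣≡∣i∣*∣j∣ a x) ⟩
  ∣ a ∣ ℕ.* ∣ x ∣ ℕ.+ ∣ dot m z ∣    ≤⟨ ℕP.+-mono-≤ (ℕP.*-monoʳ-≤ ∣ a ∣ ∣x∣≤C) (∣dot∣≤‖‖₁* m z z≤C) ⟩
  ∣ a ∣ ℕ.* C ℕ.+ ‖ m ‖₁ ℕ.* C       ≡⟨ ℕP.*-distribʳ-+ C ∣ a ∣ ‖ m ‖₁ ⟨
  (∣ a ∣ ℕ.+ ‖ m ‖₁) ℕ.* C           ∎
  where open ℕP.≤-Reasoning

∣i*x-j*y∣≤ : ∀ i j x y {b K} → ∣ x ∣ ℕ.≤ b → ∣ y ∣ ℕ.≤ b → ∣ j ∣ ℕ.≤ K →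
             ∣ i * x - j * y ∣ ℕ.≤ (∣ i ∣ ℕ.+ K) ℕ.* b
∣i*x-j*y∣≤ i j x y {b} {K} ∣x∣≤b ∣y∣≤b ∣j∣≤K = begin
  ∣ i * x - j * y ∣                  ≤⟨ ℤP.∣i-j∣≤∣i∣+∣j∣ (i * x) (j * y) ⟩
  ∣ i * x ∣ ℕ.+ ∣ j * y ∣            ≡⟨ cong₂ ℕ._+_ (ℤP.∣i*j∣≡∣i∣*∣j∣ i x) (ℤP.∣i*j∣≡∣i∣*∣j∣ j y) ⟩
  ∣ i ∣ ℕ.* ∣ x ∣ ℕ.+ ∣ j ∣ ℕ.* ∣ y ∣  ≤⟨ ℕP.+-mono-≤ (ℕP.*-monoʳ-≤ ∣ i ∣ ∣x∣≤b) (ℕP.*-mono-≤ ∣j∣≤K ∣y∣≤b) ⟩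
  ∣ i ∣ ℕ.* b ℕ.+ K ℕ.* b            ≡⟨ ℕP.*-distribʳ-+ b ∣ i ∣ K ⟨
  (∣ i ∣ ℕ.+ K) ℕ.* b                ∎
  where open ℕP.≤-Reasoning

PositiveDefinite : Mat n → Set
PositiveDefinite {n} L = ∀ (x : Vec ℤ n) → (∃ λ i → lookup x i ≢ 0ℤ) → 0ℤ < qf L x

-- Row c ∷ r of a matrix with first row a ∷ m becomes a r − c m: one step of
-- fraction-free Gaussian elimination, which clears the first column.
eliminate : ℤ → Vec ℤ n → Vec ℤ (suc n) → Vec ℤ n
eliminate a m (c ∷ r) = zipWith (λ rᵢ mᵢ → a * rᵢ - c * mᵢ) r m

scaledSchurComplement : Mat (suc n) → Mat n
scaledSchurComplement ((a ∷ m) ∷ rows) = map (eliminate a m) rows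

dot-eliminate : ∀ a c (r m z : Vec ℤ n) → dot (eliminate a m (c ∷ r)) z ≡ a * dot r z - c * dot m z
dot-eliminate a c []       []       []       = lemma a c
  where lemma : ∀ a c → 0ℤ ≡ a * 0ℤ - c * 0ℤ
        lemma = solve-∀
dot-eliminate a c (rᵢ ∷ r) (mᵢ ∷ m) (zᵢ ∷ z) rewrite dot-eliminate a c r m z =
  lemma a c rᵢ mᵢ zᵢ (dot r z) (dot m z)
  where lemma : ∀ a c rᵢ mᵢ zᵢ R M → (a * rᵢ - c * mᵢ) * zᵢ + (a * R - c * M) ≡ a * (rᵢ * zᵢ + R) - c * (mᵢ * zᵢ + M)
        lemma = solve-∀

posDef⇒pivot>0 : ∀ {a} {m : Vec ℤ n} {rows} → PositiveDefinite ((a ∷ m) ∷ rows) → 0ℤ < a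
posDef⇒pivot>0 {a = a} {m} {rows} posDef = subst (0ℤ <_) qf-e₀≡a (posDef (e zero) (zero , λ ()))
  where
  L = (a ∷ m) ∷ rows
  qf-e₀≡a : qf L (e zero) ≡ a
  qf-e₀≡a = trans (dot-e zero (L *ᴹ e zero)) (trans (dot-comm (a ∷ m) (e zero)) (dot-e zero (a ∷ m)))

-- The lift (−m·x) ∷ a x of x is mapped by L to 0 ∷ L′ x, so L[lift] = a · L′[x].
*ᴹ-lift : ∀ a (m : Vec ℤ n) rows x →
          ((a ∷ m) ∷ rows) *ᴹ ((- dot m x) ∷ a *ᵥ x) ≡ 0ℤ ∷ scaledSchurComplement ((a ∷ m) ∷ rows) *ᴹ x
*ᴹ-lift {n} a m rows x = cong₂ _∷_ pivot-row (other-rows rows)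
  where
  d = dot m x
  pivot-row : a * - d + dot m (a *ᵥ x) ≡ 0ℤ
  pivot-row rewrite dot-*ᵥʳ a m x = lemma a d
    where lemma : ∀ a d → a * - d + a * d ≡ 0ℤ
          lemma = solve-∀
  other-rows : ∀ {k} (rs : Vec (Vec ℤ (suc n)) k) → rs *ᴹ ((- d) ∷ a *ᵥ x) ≡ map (eliminate a m) rs *ᴹ x
  other-rows []             = refl
  other-rows ((c ∷ r) ∷ rs) = cong₂ _∷_ row (other-rows rs)
    where
    row : c * - d + dot r (a *ᵥ x) ≡ dot (eliminate a m (c ∷ r)) x
    row rewrite dot-*ᵥʳ a r x | dot-eliminate a c r m x = lemma c d a (dot r x)
      where lemma : ∀ c d a R → c * - d + a * R ≡ a * R - c * d
            lemma = solve-∀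

posDef-scaledSchurComplement : {L : Mat (suc n)} → PositiveDefinite L → PositiveDefinite (scaledSchurComplement L)
posDef-scaledSchurComplement {L = (a ∷ m) ∷ rows} posDef x (i , xᵢ≢0) =
  ℤP.*-cancelˡ-<-nonNeg a (subst₂ _<_ (sym (ℤP.*-zeroʳ a)) qf-lift (posDef lift (suc i , liftᵢ≢0)))
  where
  L = (a ∷ m) ∷ rows
  L′ = scaledSchurComplement L
  lift = (- dot m x) ∷ a *ᵥ x
  a>0 = posDef⇒pivot>0 posDef
  instance
    a-nonNeg : ℤ.NonNegative a
    a-nonNeg = ℤ.nonNegative (ℤP.<⇒≤ a>0)
  qf-lift : qf L lift ≡ a * qf L′ x
  qf-lift = begin
    qf L lift                        ≡⟨ cong (dot lift) (*ᴹ-lift a m rows x) ⟩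
    - dot m x * 0ℤ + dot (a *ᵥ x) (L′ *ᴹ x)  ≡⟨ cong₂ _+_ (ℤP.*-zeroʳ (- dot m x)) (dot-*ᵥˡ a x (L′ *ᴹ x)) ⟩
    0ℤ + a * qf L′ x                 ≡⟨ ℤP.+-identityˡ (a * qf L′ x) ⟩
    a * qf L′ x                      ∎
    where open ≡-Reasoning
  liftᵢ≢0 : lookup lift (suc i) ≢ 0ℤ
  liftᵢ≢0 axᵢ≡0 with ℤP.i*j≡0⇒i≡0∨j≡0 a (trans (sym (VecP.lookup-map i (a *_) x)) axᵢ≡0)
  ... | inj₁ a≡0  = ℤP.<-irrefl (sym a≡0) a>0
  ... | inj₂ xᵢ≡0 = xᵢ≢0 xᵢ≡0

0<i⇒∣j∣≤∣i*j∣ : ∀ {i} j → 0ℤ < i → ∣ j ∣ ℕ.≤ ∣ i * j ∣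
0<i⇒∣j∣≤∣i*j∣ {+ zero}  j (ℤ.+<+ ())
0<i⇒∣j∣≤∣i*j∣ {+ suc k} j _ =
  subst (∣ j ∣ ℕ.≤_) (sym (ℤP.∣i*j∣≡∣i∣*∣j∣ (+ suc k) j)) (ℕP.m≤n*m ∣ j ∣ (suc k))

BoundedPreimages : Vec (Vec ℤ n) m → Set
BoundedPreimages {n} M = ∀ b → ∃ λ C → ∀ (z : Vec ℤ n) → Bounded b (M *ᴹ z) → Bounded C z

-- Induction on the dimension through the scaled Schur complement L′: if L z is
-- bounded then so is L′ z′ for the tail z′ of z, hence z′ by induction, and
-- finally the first entry z₁ through the first row of L z.
posDef⇒boundedPreimages : {L : Mat n} → PositiveDefinite L → BoundedPreimages L
posDef⇒boundedPreimages {zero}  {[]}               _      b = 0 , λ { [] _ → [] }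
posDef⇒boundedPreimages {suc n} {(a ∷ m) ∷ rows} posDef b = C , bound
  where
  K = ‖ map head rows ‖₁
  b′ = (∣ a ∣ ℕ.+ K) ℕ.* b
  IH = posDef⇒boundedPreimages (posDef-scaledSchurComplement posDef) b′
  C′ = proj₁ IH
  C = b ℕ.+ ‖ m ‖₁ ℕ.* C′ ℕ.+ C′

  schur-bounded : ∀ {z₁ z′} → ∣ a * z₁ + dot m z′ ∣ ℕ.≤ b →
                  ∀ {k} (rs : Vec (Vec ℤ (suc n)) k) → Bounded K (map head rs) →
                  Bounded b (rs *ᴹ (z₁ ∷ z′)) → Bounded b′ (map (eliminate a m) rs *ᴹ z′)
  schur-bounded _ [] _ _ = []
  schur-bounded {z₁} {z′} first≤b ((c ∷ r) ∷ rs) (∣c∣≤K ∷ K-rs) (row≤b ∷ rows≤b) =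
    subst (λ t → ∣ t ∣ ℕ.≤ b′) (sym row-eq) (∣i*x-j*y∣≤ a c _ _ row≤b first≤b ∣c∣≤K)
    ∷ schur-bounded first≤b rs K-rs rows≤b
    where
    row-eq : dot (eliminate a m (c ∷ r)) z′ ≡ a * (c * z₁ + dot r z′) - c * (a * z₁ + dot m z′)
    row-eq rewrite dot-eliminate a c r m z′ = lemma a c z₁ (dot r z′) (dot m z′)
      where lemma : ∀ a c z₁ R M → a * R - c * M ≡ a * (c * z₁ + R) - c * (a * z₁ + M)
            lemma = solve-∀

  bound : ∀ z → Bounded b (((a ∷ m) ∷ rows) *ᴹ z) → Bounded C z
  bound (z₁ ∷ z′) (first≤b ∷ rows≤b) = ∣z₁∣≤C ∷ bounded-mono (ℕP.m≤n+m C′ _) z′≤C′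
    where
    z′≤C′ : Bounded C′ z′
    z′≤C′ = proj₂ IH z′ (schur-bounded first≤b rows (bounded-‖‖₁ (map head rows)) rows≤b)
    split : ∀ a z₁ M → a * z₁ ≡ (a * z₁ + M) - M
    split = solve-∀
    ∣z₁∣≤C : ∣ z₁ ∣ ℕ.≤ C
    ∣z₁∣≤C = begin
      ∣ z₁ ∣                                    ≤⟨ 0<i⇒∣j∣≤∣i*j∣ z₁ (posDef⇒pivot>0 posDef) ⟩
      ∣ a * z₁ ∣                                ≡⟨ cong ∣_∣ (split a z₁ (dot m z′)) ⟩
      ∣ (a * z₁ + dot m z′) - dot m z′ ∣        ≤⟨ ℤP.∣i-j∣≤∣i∣+∣j∣ (a * z₁ + dot m z′) (dot m z′) ⟩
      ∣ a * z₁ + dot m z′ ∣ ℕ.+ ∣ dot m z′ ∣    ≤⟨ ℕP.+-mono-≤ first≤b (∣dot∣≤‖‖₁* m z′ z′≤C′) ⟩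
      b ℕ.+ ‖ m ‖₁ ℕ.* C′                       ≤⟨ ℕP.m≤m+n _ C′ ⟩
      C                                         ∎
      where open ℕP.≤-Reasoning

classMinimal-bounded : {L : Mat n} → IsSymmetric L → PositiveDefinite L →
                       ∃ λ C → ∀ x → ClassMinimal L x → Bounded C x
classMinimal-bounded {L = L} sym-L posDef = C , bound
  where
  q = tabulate (λ i → qf L (L *ᴹ e i))
  preimage = posDef⇒boundedPreimages posDef
  C₁ = proj₁ (preimage ‖ q ‖₁)
  C = proj₁ (preimage C₁)
  bound : ∀ x → ClassMinimal L x → Bounded C x
  bound x min-x = proj₂ (preimage C₁) x (proj₂ (preimage ‖ q ‖₁) (L *ᴹ x) LLx≤‖q‖₁)
    where
    qᵢ≤‖q‖₁ : ∀ i → ∣ qf L (L *ᴹ e i) ∣ ℕ.≤ ‖ q ‖₁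
    qᵢ≤‖q‖₁ i = subst (λ t → ∣ t ∣ ℕ.≤ ‖ q ‖₁) (VecP.lookup∘tabulate _ i) (lookup⁺ (bounded-‖‖₁ q) i)
    LLx≤‖q‖₁ : Bounded ‖ q ‖₁ (L *ᴹ L *ᴹ x)
    LLx≤‖q‖₁ = lookup⁻ λ i → ℕP.≤-trans (classMinimal-coordinate sym-L min-x i) (qᵢ≤‖q‖₁ i)

SuperIncreasing : ℕ → Vec ℤ n → Set
SuperIncreasing C []      = ⊤
SuperIncreasing C (a ∷ s) = (C ℕ.+ C) ℕ.* ‖ s ‖₁ ℕ.< ∣ a ∣ × SuperIncreasing C s

-- If the first entries of u and v differ, a (u₁ − v₁) = s·v − s·u has absolute
-- value at least ∣a∣ but at most 2C‖s‖₁.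
superIncreasing-injective : ∀ {C} (s u v : Vec ℤ n) → SuperIncreasing C s →
                            Bounded C u → Bounded C v → dot s u ≡ dot s v → u ≡ v
superIncreasing-injective []      []       []       _ _ _ _ = refl
superIncreasing-injective {C = C} (a ∷ s) (u₁ ∷ u) (v₁ ∷ v) (dominant , s-inc) (_ ∷ u≤C) (_ ∷ v≤C) s·u≡s·v
  with u₁ ℤ.≟ v₁
... | yes refl = cong (u₁ ∷_) (superIncreasing-injective s u v s-inc u≤C v≤C tails)
  where
  cancel : ∀ p X → X ≡ (p + X) - p
  cancel = solve-∀
  tails : dot s u ≡ dot s v
  tails = trans (cancel (a * u₁) (dot s u))
                (trans (cong (_- a * u₁) s·u≡s·v) (sym (cancel (a * u₁) (dot s v))))
... | no u₁≢v₁ = ⊥-elim (ℕP.<⇒≱ dominant ∣a∣≤)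
  where
  U = dot s u
  V = dot s v
  difference : a * (u₁ - v₁) ≡ V - U
  difference = begin
    a * (u₁ - v₁)                               ≡⟨ expand a u₁ v₁ U V ⟩
    (a * u₁ + U) - (a * v₁ + V) + (V - U)       ≡⟨ cong (λ t → t - (a * v₁ + V) + (V - U)) s·u≡s·v ⟩
    (a * v₁ + V) - (a * v₁ + V) + (V - U)       ≡⟨ collapse (a * v₁ + V) (V - U) ⟩
    V - U                                       ∎
    where
    open ≡-Reasoning
    expand : ∀ a u₁ v₁ U V → a * (u₁ - v₁) ≡ (a * u₁ + U) - (a * v₁ + V) + (V - U)
    expand = solve-∀
    collapse : ∀ P Q → P - P + Q ≡ Q
    collapse = solve-∀
  instance
    nonZero : ℕ.NonZero ∣ u₁ - v₁ ∣
    nonZero = ℕ.≢-nonZero (λ ∣u₁-v₁∣≡0 → u₁≢v₁ (ℤP.i-j≡0⇒i≡j u₁ v₁ (ℤP.∣i∣≡0⇒i≡0 ∣u₁-v₁∣≡0)))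
  ∣a∣≤ : ∣ a ∣ ℕ.≤ (C ℕ.+ C) ℕ.* ‖ s ‖₁
  ∣a∣≤ = begin
    ∣ a ∣                                 ≤⟨ ℕP.m≤m*n ∣ a ∣ ∣ u₁ - v₁ ∣ ⟩
    ∣ a ∣ ℕ.* ∣ u₁ - v₁ ∣                 ≡⟨ ℤP.∣i*j∣≡∣i∣*∣j∣ a (u₁ - v₁) ⟨
    ∣ a * (u₁ - v₁) ∣                     ≡⟨ cong ∣_∣ difference ⟩
    ∣ V - U ∣                             ≤⟨ ℤP.∣i-j∣≤∣i∣+∣j∣ V U ⟩
    ∣ V ∣ ℕ.+ ∣ U ∣                       ≤⟨ ℕP.+-mono-≤ (∣dot∣≤‖‖₁* s v v≤C) (∣dot∣≤‖‖₁* s u u≤C) ⟩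
    ‖ s ‖₁ ℕ.* C ℕ.+ ‖ s ‖₁ ℕ.* C         ≡⟨ ℕP.*-distribˡ-+ ‖ s ‖₁ C C ⟨
    ‖ s ‖₁ ℕ.* (C ℕ.+ C)                  ≡⟨ ℕP.*-comm ‖ s ‖₁ (C ℕ.+ C) ⟩
    (C ℕ.+ C) ℕ.* ‖ s ‖₁                  ∎
    where open ℕP.≤-Reasoning

-- Each entry exceeds 2C times the ℓ¹-norm of the tail plus one, so that adding
-- a standard basis vector keeps the vector super-increasing.
separator : ℕ → (n : ℕ) → Vec ℤ n
separator C zero    = []
separator C (suc n) = + suc ((C ℕ.+ C) ℕ.* suc ‖ separator C n ‖₁) ∷ separator C n

dominates-separator : ∀ C n → (C ℕ.+ C) ℕ.* ‖ separator C n ‖₁ ℕ.< suc ((C ℕ.+ C) ℕ.* suc ‖ separator C n ‖₁)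
dominates-separator C n = ℕ.s≤s (ℕP.*-monoʳ-≤ (C ℕ.+ C) (ℕP.n≤1+n _))

superIncreasing-separator : ∀ C n → SuperIncreasing C (separator C n)
superIncreasing-separator C zero    = tt
superIncreasing-separator C (suc n) = dominates-separator C n , superIncreasing-separator C n

‖separator+e‖₁ : ∀ C (i : Fin n) → ‖ separator C n +ᵥ e i ‖₁ ≡ suc ‖ separator C n ‖₁
‖separator+e‖₁ {suc n} C zero rewrite +ᵥ-identityʳ (separator C n) =
  cong (ℕ._+ ‖ separator C n ‖₁) (ℕP.+-comm _ 1)
‖separator+e‖₁ {suc n} C (suc i) rewrite ℕP.+-identityʳ ((C ℕ.+ C) ℕ.* suc ‖ separator C n ‖₁)
                                       | ‖separator+e‖₁ C i =
  ℕP.+-suc _ ‖ separator C n ‖₁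

superIncreasing-separator+e : ∀ C (i : Fin n) → SuperIncreasing C (separator C n +ᵥ e i)
superIncreasing-separator+e {suc n} C zero rewrite +ᵥ-identityʳ (separator C n) =
  ℕP.≤-trans (dominates-separator C n) (ℕP.m≤m+n _ 1) , superIncreasing-separator C n
superIncreasing-separator+e {suc n} C (suc i)
  rewrite ℕP.+-identityʳ ((C ℕ.+ C) ℕ.* suc ‖ separator C n ‖₁) | ‖separator+e‖₁ C i =
  ℕP.n<1+n _ , superIncreasing-separator+e C i

separatingSet : ℕ → (n : ℕ) → List (Vec ℤ n)
separatingSet C n = separator C n List.∷ List.map (λ i → separator C n +ᵥ e i) (List.allFin n)

superIncreasing-separatingSet : ∀ C {s : Vec ℤ n} → s ∈ separatingSet C n → SuperIncreasing C s
superIncreasing-separatingSet {n} C (here refl) = superIncreasing-separator C n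
superIncreasing-separatingSet C (there s∈) with ∈-map⁻ _ s∈
... | i , _ , refl = superIncreasing-separator+e C i

InSpan : List (Vec ℤ n) → Vec ℤ n → Set
InSpan S x = ∃ λ cs → comb S cs ≡ x

basis-induction : (P : Vec ℤ n → Set) → P 0ᵥ → (∀ {u v} → P u → P v → P (u +ᵥ v)) →
                  (∀ c {u} → P u → P (c *ᵥ u)) → (∀ i → P (e i)) → ∀ x → P x
basis-induction {zero}  P P0 P+ P* Pe []       = P0
basis-induction {suc n} P P0 P+ P* Pe (a ∷ x) = subst P a∷x (P+ (P* a (Pe zero)) P0∷x)
  where
  P0∷x : P (0ℤ ∷ x)
  P0∷x = basis-induction (λ v → P (0ℤ ∷ v)) P0 P+
           (λ c {u} Pu → subst (λ t → P (t ∷ c *ᵥ u)) (ℤP.*-zeroʳ c) (P* c Pu)) (λ i → Pe (suc i)) x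
  a∷x : a *ᵥ e zero +ᵥ (0ℤ ∷ x) ≡ a ∷ x
  a∷x rewrite *ᵥ-zeroʳ {n} a | +ᵥ-identityˡ x = cong (_∷ x) (trans (ℤP.+-identityʳ _) (ℤP.*-identityʳ a))

*ᵥ-zeroˡ : (u : Vec ℤ n) → 0ℤ *ᵥ u ≡ 0ᵥ
*ᵥ-zeroˡ u = VecP.map-const u 0ℤ

*ᵥ-+ᵥ-interchange : ∀ c d (s x y : Vec ℤ n) → (c + d) *ᵥ s +ᵥ (x +ᵥ y) ≡ (c *ᵥ s +ᵥ x) +ᵥ (d *ᵥ s +ᵥ y)
*ᵥ-+ᵥ-interchange c d []      []      []      = refl
*ᵥ-+ᵥ-interchange c d (a ∷ s) (x ∷ X) (y ∷ Y) = cong₂ _∷_ (lemma c d a x y) (*ᵥ-+ᵥ-interchange c d s X Y)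
  where lemma : ∀ c d a x y → (c + d) * a + (x + y) ≡ (c * a + x) + (d * a + y)
        lemma = solve-∀

*ᵥ-distribˡ-+ᵥ : ∀ k c (s x : Vec ℤ n) → (k * c) *ᵥ s +ᵥ k *ᵥ x ≡ k *ᵥ (c *ᵥ s +ᵥ x)
*ᵥ-distribˡ-+ᵥ k c []      []      = refl
*ᵥ-distribˡ-+ᵥ k c (a ∷ s) (x ∷ X) = cong₂ _∷_ (lemma k c a x) (*ᵥ-distribˡ-+ᵥ k c s X)
  where lemma : ∀ k c a x → (k * c) * a + k * x ≡ k * (c * a + x)
        lemma = solve-∀

+ᵥ-*ᵥ-cancel : (t u : Vec ℤ n) → (t +ᵥ u) +ᵥ (- 1ℤ) *ᵥ t ≡ u
+ᵥ-*ᵥ-cancel []      []      = refl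
+ᵥ-*ᵥ-cancel (a ∷ t) (b ∷ u) = cong₂ _∷_ (lemma a b) (+ᵥ-*ᵥ-cancel t u)
  where lemma : ∀ a b → (a + b) + (- 1ℤ) * a ≡ b
        lemma = solve-∀

comb-zero : (S : List (Vec ℤ n)) → comb S 0ᵥ ≡ 0ᵥ
comb-zero List.[]      = refl
comb-zero (s List.∷ S) rewrite comb-zero S | *ᵥ-zeroˡ s = +ᵥ-identityˡ 0ᵥ

comb-+ᵥ : (S : List (Vec ℤ n)) (cs ds : Vec ℤ (length S)) → comb S (cs +ᵥ ds) ≡ comb S cs +ᵥ comb S ds
comb-+ᵥ List.[]      []       []       = sym (+ᵥ-identityˡ 0ᵥ)
comb-+ᵥ (s List.∷ S) (c ∷ cs) (d ∷ ds) rewrite comb-+ᵥ S cs ds = *ᵥ-+ᵥ-interchange c d s (comb S cs) (comb S ds)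

comb-*ᵥ : (S : List (Vec ℤ n)) (k : ℤ) (cs : Vec ℤ (length S)) → comb S (k *ᵥ cs) ≡ k *ᵥ comb S cs
comb-*ᵥ List.[]      k []       = sym (*ᵥ-zeroʳ k)
comb-*ᵥ (s List.∷ S) k (c ∷ cs) rewrite comb-*ᵥ S k cs = *ᵥ-distribˡ-+ᵥ k c s (comb S cs)

inSpan-∈ : {S : List (Vec ℤ n)} {s : Vec ℤ n} → s ∈ S → InSpan S s
inSpan-∈ {S = s List.∷ S} (here refl) = (1ℤ ∷ 0ᵥ) , s≡
  where
  s≡ : 1ℤ *ᵥ s +ᵥ comb S 0ᵥ ≡ s
  s≡ rewrite comb-zero S | *ᵥ-identityˡ s = +ᵥ-identityʳ s
inSpan-∈ {S = t List.∷ S} (there s∈S) with inSpan-∈ s∈S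
... | cs , comb≡s = (0ℤ ∷ cs) , trans (cong (_+ᵥ comb S cs) (*ᵥ-zeroˡ t)) (trans (+ᵥ-identityˡ _) comb≡s)

inSpan-+ᵥ : {S : List (Vec ℤ n)} {u v : Vec ℤ n} → InSpan S u → InSpan S v → InSpan S (u +ᵥ v)
inSpan-+ᵥ {S = S} (cs , refl) (ds , refl) = cs +ᵥ ds , comb-+ᵥ S cs ds

inSpan-*ᵥ : {S : List (Vec ℤ n)} (k : ℤ) {u : Vec ℤ n} → InSpan S u → InSpan S (k *ᵥ u)
inSpan-*ᵥ {S = S} k (cs , refl) = k *ᵥ cs , comb-*ᵥ S k cs

spans-by-basis : (S : List (Vec ℤ n)) → (∀ i → InSpan S (e i)) → Spans S
spans-by-basis S = basis-induction (InSpan S) (0ᵥ , comb-zero S) (inSpan-+ᵥ {S = S}) (inSpan-*ᵥ {S = S})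

spans-separatingSet : ∀ C n → Spans (separatingSet C n)
spans-separatingSet C n = spans-by-basis S λ i →
  subst (InSpan S) (+ᵥ-*ᵥ-cancel t (e i))
    (inSpan-+ᵥ (inSpan-∈ (there (∈-map⁺ (λ i → t +ᵥ e i) (∈-allFin i))))
               (inSpan-*ᵥ (- 1ℤ) (inSpan-∈ (here refl))))
  where
  t = separator C n
  S = separatingSet C n

lemma4p2 : (N : ℕ) (L : Mat N) → IsEvenPosDefGram L
         → (R : Vecℤ N → Set) → IsMinimalReps L R
         → (r : Vecℤ N) → R r ⊎ R (neg r)
         → Σ (List (Vecℤ N)) λ S → Spans S
           × (∀ s r' → s ∈ S
              → (∃ λ r'' → R r'' × (Neigh L r'' r' ⊎ Neigh L (neg r'') r'))
              → dot s r ≡ dot s r' → r ≡ r')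
lemma4p2 N L (sym-L , _ , posDef) R (_ , _ , minimal) r r∈±R =
  separatingSet C N , spans-separatingSet C N , separates
  where
  C = proj₁ (classMinimal-bounded sym-L posDef)
  bounded = proj₂ (classMinimal-bounded sym-L posDef)
  minimal-r : ClassMinimal L r
  minimal-r = [ minimal r
              , (λ -r∈R → subst (ClassMinimal L) (neg-involutive r) (classMinimal-neg (minimal (neg r) -r∈R))) ]′ r∈±R
  separates : ∀ s r′ → s ∈ separatingSet C N
            → (∃ λ r″ → R r″ × (Neigh L r″ r′ ⊎ Neigh L (neg r″) r′))
            → dot s r ≡ dot s r′ → r ≡ r′
  separates s r′ s∈S (r″ , r″∈R , neighbour) =
    superIncreasing-injective s r r′ (superIncreasing-separatingSet C s∈S) (bounded r minimal-r) (bounded r′ minimal-r′)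
    where
    minimal-r′ : ClassMinimal L r′
    minimal-r′ = [ classMinimal-neigh (minimal r″ r″∈R)
                 , classMinimal-neigh (classMinimal-neg (minimal r″ r″∈R)) ]′ neighbour
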